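{- Let $1\le k\le n$. Suppose that the algorithm $\mathcal{A}_{\mathrm{MLE}}$, given i.i.d. samples from $\mathcal{D}\in\{\mathcal{U}_n\}\cup\mathcal{P}_n(k)$, outputs "un-truncated" with probability at least $99/100$ when $\mathcal{D}=\mathcal{U}_n$ and outputs "truncated" with probability at least $99/100$ when $\mathcal{D}\in\mathcal{P}_n(k)$. Then $\mathcal{A}_{\mathrm{MLE}}$ must draw at least $\log\binom{n}{k}$ samples from $\mathcal{D}$.
   Context: Identify $\{0,1\}^n$ with $\mathbb{F}_2^n$; $\mathcal{U}_n$ is the uniform distribution on it. For $S\subseteq[n]$, $\chi_S(x):=1-\sum_{i\in S}x_i$ (in $\mathbb{F}_2$). $\mathcal{P}_n(k):=\{\mathcal{U}_n|_{\chi_S^{ -1}(1)} : |S|=k\}$, where $\mathcal{U}_n|_{\chi_S^{ -1}(1)}$ is uniform on $\{x:\chi_S(x)=1\}$. The algorithm $\mathcal{A}_{\mathrm{MLE}}$: given $T$ samples $\bar x=(x^{(1)},\dots,x^{(T)})$, it outputs "truncated" if \[\mathbb{E}_{\mathcal{D}'\in\mathcal{P}_n(k)}\Big[\Pr_{y^{(1)},\dots,y^{(T)}\sim\mathcal{D}'}[\bar y=\bar x]\Big]\ \ge\ \Pr_{y^{(1)},\dots,y^{(T)}\sim\mathcal{U}_n}[\bar y=\bar x],\] where $\bar y=(y^{(1)},\dots,y^{(T)})$ are i.i.d. and $\mathcal{D}'$ is uniform over $\mathcal{P}_n(k)$, and outputs "un-truncated" otherwise. Logarithms are base 2. -}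

module Defs where

import Data.Bool
open import Data.Bool using (Bool; true; false; not; _∧_; _xor_; if_then_else_)
open import Data.Nat as ℕ using (ℕ; zero; suc)
open import Data.Integer using (+_)
open import Data.Rational using (ℚ; 0ℚ; 1ℚ; _+_; _*_; _/_; _≤ᵇ_)
open import Data.List using (List; []; _∷_; map; concatMap; filter; length; foldr)
open import Data.Vec using (Vec; []; _∷_; zipWith)
import Data.Fin.Subset
open import Data.Fin.Subset using (Subset)
open import Relation.Nullary.Decidable using (does)
open import Relation.Binary.PropositionalEquality using (_≡_)

-- A point of F_2^n, encoded as a Bool vector (true = 1).
Pt : ℕ → Set
Pt n = Vec Bool n

allPts : (n : ℕ) → List (Pt n)
allPts zero = [] ∷ []
allPts (suc n) = concatMap (λ v → (false ∷ v) ∷ (true ∷ v) ∷ []) (allPts n)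

allTuples : (n T : ℕ) → List (Vec (Pt n) T)
allTuples n zero = [] ∷ []
allTuples n (suc T) = concatMap (λ xs → map (λ x → x ∷ xs) (allPts n)) (allTuples n T)

parity : ∀ {n} → Vec Bool n → Bool
parity [] = false
parity (b ∷ bs) = b xor parity bs

chi : ∀ {n} → Subset n → Pt n → Bool
chi S x = not (parity (zipWith _∧_ S x))

-- 1/m as a rational (with the convention 1/0 = 0; only used for nonempty supports).
inv : ℕ → ℚ
inv zero = 0ℚ
inv (suc m) = + 1 / suc m

Dist : ℕ → Set
Dist n = Pt n → ℚ

U : (n : ℕ) → Dist n
U n x = inv (length (allPts n))

Utrunc : ∀ {n} → Subset n → Dist n
Utrunc {n} S x = if chi S x then inv (length (filter (λ y → Data.Bool._≟_ (chi S y) true) (allPts n))) else 0ℚ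

sumℚ : List ℚ → ℚ
sumℚ = foldr _+_ 0ℚ

tupleProb : ∀ {n T} → Dist n → Vec (Pt n) T → ℚ
tupleProb D [] = 1ℚ
tupleProb D (x ∷ xs) = D x * tupleProb D xs

allSubsets : (n : ℕ) → List (Subset n)
allSubsets = allPts

Pk : (n k : ℕ) → List (Subset n)
Pk n k = filter (λ S → Data.Fin.Subset.∣ S ∣ ℕ.≟ k) (allSubsets n)

-- The algorithm A_MLE: true = "truncated", false = "un-truncated".
mle : (n k T : ℕ) → Vec (Pt n) T → Bool
mle n k T xs =
  tupleProb (U n) xs ≤ᵇ (inv (length (Pk n k)) * sumℚ (map (λ S → tupleProb (Utrunc S) xs) (Pk n k)))

probOutput : (n k T : ℕ) → Dist n → Bool → ℚ
probOutput n k T D b =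
  sumℚ (map (λ xs → if does (Data.Bool._≟_ (mle n k T xs) b) then tupleProb D xs else 0ℚ) (allTuples n T))

-- Write M = n C k, Q = 2^T and N = 2^(nT) for the number of sample tuples x̄, and let c(x̄)
-- be the number of sets S of size k with every sample of x̄ in χ_S⁻¹(1).  For nonzero S the
-- characters χ_S are balanced and pairwise independent, so Q² Σ c² ≤ M² N + M Q N.
-- A test that is right with probability 99/100 says "truncated" on at most N/100 tuples,
-- yet averaged over S those tuples carry 99% of the truncated mass: 99 M N ≤ 100 Q Σ c
-- over them.  AM–GM in the form 2·(Q c)(10 M) ≤ Q² c² + 100 M² combines the two bounds
-- into M ≤ Q.  Nothing about A_MLE is used beyond its two success probabilities.
module Submission where

open import Defs
open import Data.Bool using (true; false)
open import Data.Nat using (ℕ; _≤_; _^_)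
open import Data.Nat.Combinatorics using (_C_)
open import Data.Integer using (+_)
open import Data.Rational using (_/_)
open import Data.Fin.Subset using (Subset; ∣_∣)
open import Relation.Binary.PropositionalEquality using (_≡_)
import Data.Rational as Q

open import Level using (Level)
open import Function using (_∘_; _∋_)
open import Data.Bool using (Bool; not; _∧_; _xor_; if_then_else_)
import Data.Bool as Bool
open import Data.Bool.Properties using (∧-distribʳ-xor; xor-annihilates-not; xor-∧-commutativeRing)
open import Data.Sum using (inj₁; inj₂)
open import Data.Nat using (zero; suc; _+_; _*_; _∸_; _<_; z≤n; NonZero; >-nonZero)
open import Data.Nat.Properties
open import Data.Nat.Combinatorics using (nCk+nC[k+1]≡[n+1]C[k+1])
open import Data.Nat.Tactic.RingSolver using (solve)
import Data.Integer as ℤ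
import Data.Integer.Properties as ℤP
open import Data.Rational using (ℚ; 0ℚ; 1ℚ; toℚᵘ; +-*-rawSemiring)
import Data.Rational.Properties as QP
open import Data.Rational.Unnormalised using (mkℚᵘ; *≡*; *≤*) renaming (_≃_ to _≃ᵘ_; _+_ to _+ᵘ_; _*_ to _*ᵘ_)
import Data.Rational.Unnormalised.Properties as ᵘP
open import Algebra.Bundles using (CommutativeMonoid; CommutativeRing)
open import Algebra.Definitions.RawSemiring +-*-rawSemiring using () renaming (_^_ to _^ᵠ_)
import Algebra.Properties.CommutativeSemigroup as CommutativeSemigroupProperties
open import Data.List using (List; []; _∷_; _++_; map; concatMap; filter; length)
open import Data.Vec using (Vec; []; _∷_; zipWith; tail)
open import Data.Vec.Properties using (≡-dec)
open import Data.Fin.Subset using (⊥)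
open import Data.Fin.Subset.Properties using (∣⊥∣≡0)
open import Relation.Nullary.Decidable using (Dec; does; yes; no)
open import Relation.Nullary.Negation using (contradiction)
open import Relation.Unary using (Pred; Decidable)
open import Relation.Binary.PropositionalEquality
  using (refl; sym; trans; cong; cong₂; subst; subst₂; _≢_; module ≡-Reasoning)

open CommutativeSemigroupProperties +-commutativeSemigroup using () renaming (interchange to +-interchange)
open CommutativeSemigroupProperties *-commutativeSemigroup using () renaming (interchange to *-interchange; x∙yz≈y∙xz to x*yz≡y*xz)

private variable
  a p : Level
  A B : Set a

-- Indicators and finite sums
𝟙 : Bool → ℕ
𝟙 b = if b then 1 else 0

𝟙-not : ∀ b → 𝟙 b + 𝟙 (not b) ≡ 1
𝟙-not true = refl
𝟙-not false = refl

𝟙-idem : ∀ b → 𝟙 b * 𝟙 b ≡ 𝟙 b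
𝟙-idem true = refl
𝟙-idem false = refl

𝟙-agreement : ∀ b c → 𝟙 b * 𝟙 c + 𝟙 (not b) * 𝟙 (not c) ≡ 𝟙 (not (b xor c))
𝟙-agreement true true = refl
𝟙-agreement true false = refl
𝟙-agreement false true = refl
𝟙-agreement false false = refl

𝟙-not-* : ∀ b m → 𝟙 b * m + 𝟙 (not b) * m ≡ m
𝟙-not-* b m = trans (sym (*-distribʳ-+ m (𝟙 b) (𝟙 (not b)))) (trans (cong (_* m) (𝟙-not b)) (+-identityʳ m))

*-𝟙-not : ∀ m b → m * 𝟙 b + m * 𝟙 (not b) ≡ m
*-𝟙-not m b = trans (sym (*-distribˡ-+ m (𝟙 b) (𝟙 (not b)))) (trans (cong (m *_) (𝟙-not b)) (*-identityʳ m))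

𝟙-≟-partition : ∀ b c → 𝟙 (does (b Bool.≟ c)) + 𝟙 (does (b Bool.≟ not c)) ≡ 1
𝟙-≟-partition true true = refl
𝟙-≟-partition true false = refl
𝟙-≟-partition false true = refl
𝟙-≟-partition false false = refl

𝟙-≟-true : ∀ b → 𝟙 (does (b Bool.≟ true)) ≡ 𝟙 b
𝟙-≟-true true = refl
𝟙-≟-true false = refl

∑ : List A → (A → ℕ) → ℕ
∑ [] f = 0
∑ (x ∷ xs) f = f x + ∑ xs f

syntax ∑ xs (λ x → e) = ∑[ x ∈ xs ] e

∑-++ : ∀ (xs ys : List A) f → ∑ (xs ++ ys) f ≡ ∑ xs f + ∑ ys f
∑-++ [] ys f = refl
∑-++ (x ∷ xs) ys f = trans (cong (_+_ (f x)) (∑-++ xs ys f)) (sym (+-assoc (f x) _ _))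

∑-concatMap : ∀ (g : A → List B) xs f → ∑ (concatMap g xs) f ≡ ∑[ x ∈ xs ] ∑ (g x) f
∑-concatMap g [] f = refl
∑-concatMap g (x ∷ xs) f =
  trans (∑-++ (g x) (concatMap g xs) f) (cong (_+_ (∑ (g x) f)) (∑-concatMap g xs f))

∑-map : ∀ (g : A → B) xs f → ∑ (map g xs) f ≡ ∑[ x ∈ xs ] f (g x)
∑-map g [] f = refl
∑-map g (x ∷ xs) f = cong (_+_ (f (g x))) (∑-map g xs f)

∑-cong : ∀ (xs : List A) {f g} → (∀ x → f x ≡ g x) → ∑ xs f ≡ ∑ xs g
∑-cong [] f≗g = refl
∑-cong (x ∷ xs) f≗g = cong₂ _+_ (f≗g x) (∑-cong xs f≗g)

∑-mono-≤ : ∀ (xs : List A) {f g} → (∀ x → f x ≤ g x) → ∑ xs f ≤ ∑ xs g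
∑-mono-≤ [] f≤g = z≤n
∑-mono-≤ (x ∷ xs) f≤g = +-mono-≤ (f≤g x) (∑-mono-≤ xs f≤g)

∑-distrib-+ : ∀ (xs : List A) f g → ∑[ x ∈ xs ] (f x + g x) ≡ ∑ xs f + ∑ xs g
∑-distrib-+ [] f g = refl
∑-distrib-+ (x ∷ xs) f g =
  trans (cong (_+_ (f x + g x)) (∑-distrib-+ xs f g)) (+-interchange (f x) (g x) (∑ xs f) (∑ xs g))

∑-double : ∀ (xs : List A) f → ∑[ x ∈ xs ] (f x + f x) ≡ 2 * ∑ xs f
∑-double xs f = trans (∑-distrib-+ xs f f) (cong (_+_ (∑ xs f)) (sym (+-identityʳ (∑ xs f))))

*-distribˡ-∑ : ∀ c (xs : List A) f → c * ∑ xs f ≡ ∑[ x ∈ xs ] (c * f x)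
*-distribˡ-∑ c [] f = *-zeroʳ c
*-distribˡ-∑ c (x ∷ xs) f = trans (*-distribˡ-+ c (f x) _) (cong (_+_ (c * f x)) (*-distribˡ-∑ c xs f))

*-distribʳ-∑ : ∀ c (xs : List A) f → ∑ xs f * c ≡ ∑[ x ∈ xs ] (f x * c)
*-distribʳ-∑ c [] f = refl
*-distribʳ-∑ c (x ∷ xs) f = trans (*-distribʳ-+ c (f x) _) (cong (_+_ (f x * c)) (*-distribʳ-∑ c xs f))

∑-const : ∀ (xs : List A) c → ∑[ _ ∈ xs ] c ≡ length xs * c
∑-const [] c = refl
∑-const (_ ∷ xs) c = cong (_+_ c) (∑-const xs c)

∑-comm : ∀ (xs : List A) (ys : List B) (f : A → B → ℕ) → ∑[ x ∈ xs ] ∑[ y ∈ ys ] f x y ≡ ∑[ y ∈ ys ] ∑[ x ∈ xs ] f x y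
∑-comm [] ys f = sym (trans (∑-const ys 0) (*-zeroʳ (length ys)))
∑-comm (x ∷ xs) ys f =
  trans (cong (_+_ (∑ ys (f x))) (∑-comm xs ys f)) (sym (∑-distrib-+ ys (f x) _))

length-filter : ∀ {P : Pred A p} (P? : Decidable P) xs → length (filter P? xs) ≡ ∑[ x ∈ xs ] 𝟙 (does (P? x))
length-filter P? [] = refl
length-filter P? (x ∷ xs) with does (P? x)
... | true = cong suc (length-filter P? xs)
... | false = length-filter P? xs

∑-filter-≤ : ∀ {P : Pred A p} (P? : Decidable P) xs f → ∑ (filter P? xs) f ≤ ∑ xs f
∑-filter-≤ P? [] f = z≤n
∑-filter-≤ P? (x ∷ xs) f with does (P? x)
... | true = +-monoʳ-≤ (f x) (∑-filter-≤ P? xs f)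
... | false = m≤n⇒m≤o+n (f x) (∑-filter-≤ P? xs f)

∑-filter-mono-≤ : ∀ {P : Pred A p} (P? : Decidable P) xs {f g} →
  (∀ x → P x → f x ≤ g x) → ∑ (filter P? xs) f ≤ ∑ (filter P? xs) g
∑-filter-mono-≤ P? [] f≤g = z≤n
∑-filter-mono-≤ P? (x ∷ xs) f≤g with P? x
... | yes px = +-mono-≤ (f≤g x px) (∑-filter-mono-≤ P? xs f≤g)
... | no _ = ∑-filter-mono-≤ P? xs f≤g

∏ : ∀ {T} → (A → ℕ) → Vec A T → ℕ
∏ h [] = 1
∏ h (x ∷ xs) = h x * ∏ h xs

∏-* : ∀ {T} f g (xs : Vec A T) → ∏ f xs * ∏ g xs ≡ ∏ (λ x → f x * g x) xs
∏-* f g [] = refl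
∏-* f g (x ∷ xs) = trans (*-interchange (f x) (∏ f xs) (g x) (∏ g xs)) (cong (f x * g x *_) (∏-* f g xs))

^-distribʳ-* : ∀ m n o → (m * n) ^ o ≡ m ^ o * n ^ o
^-distribʳ-* m n zero = refl
^-distribʳ-* m n (suc o) = trans (cong (m * n *_) (^-distribʳ-* m n o)) (*-interchange m n (m ^ o) (n ^ o))

-- The cube F₂ⁿ and its characters
∑-allPts-suc : ∀ n (f : Pt (suc n) → ℕ) → ∑ (allPts (suc n)) f ≡ ∑[ v ∈ allPts n ] (f (false ∷ v) + f (true ∷ v))
∑-allPts-suc n f = trans (∑-concatMap (λ v → (false ∷ v) ∷ (true ∷ v) ∷ []) (allPts n) f)
  (∑-cong (allPts n) λ v → cong (_+_ (f (false ∷ v))) (+-identityʳ (f (true ∷ v))))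

∑-allPts-1 : ∀ n → ∑[ _ ∈ allPts n ] 1 ≡ 2 ^ n
∑-allPts-1 zero = refl
∑-allPts-1 (suc n) = trans (∑-allPts-suc n _) (trans (∑-double (allPts n) _) (cong (2 *_) (∑-allPts-1 n)))

length-allPts : ∀ n → length (allPts n) ≡ 2 ^ n
length-allPts n = trans (sym (*-identityʳ _)) (trans (sym (∑-const (allPts n) 1)) (∑-allPts-1 n))

∑-allTuples-∏ : ∀ n T (h : Pt n → ℕ) → ∑ (allTuples n T) (∏ h) ≡ (∑ (allPts n) h) ^ T
∑-allTuples-∏ n zero h = refl
∑-allTuples-∏ n (suc T) h = begin
  ∑ (concatMap (λ xs → map (_∷ xs) (allPts n)) (allTuples n T)) (∏ h)
    ≡⟨ ∑-concatMap (λ xs → map (_∷ xs) (allPts n)) (allTuples n T) (∏ h) ⟩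
  ∑[ xs ∈ allTuples n T ] ∑ (map (_∷ xs) (allPts n)) (∏ h)
    ≡⟨ ∑-cong (allTuples n T) (λ xs → ∑-map (_∷ xs) (allPts n) (∏ h)) ⟩
  ∑[ xs ∈ allTuples n T ] ∑[ x ∈ allPts n ] (h x * ∏ h xs)
    ≡⟨ ∑-cong (allTuples n T) (λ xs → sym (*-distribʳ-∑ (∏ h xs) (allPts n) h)) ⟩
  ∑[ xs ∈ allTuples n T ] (∑ (allPts n) h * ∏ h xs)
    ≡⟨ sym (*-distribˡ-∑ (∑ (allPts n) h) (allTuples n T) (∏ h)) ⟩
  ∑ (allPts n) h * ∑ (allTuples n T) (∏ h)
    ≡⟨ cong (∑ (allPts n) h *_) (∑-allTuples-∏ n T h) ⟩
  ∑ (allPts n) h * (∑ (allPts n) h) ^ T ∎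
  where open ≡-Reasoning

_≟ₛ_ : ∀ {n} (S S' : Subset n) → Dec (S ≡ S')
_≟ₛ_ = ≡-dec Bool._≟_

∑-allPts-𝟙-≟ : ∀ {n} (S : Subset n) → ∑[ x ∈ allPts n ] 𝟙 (does (x ≟ₛ S)) ≡ 1
∑-allPts-𝟙-≟ [] = refl
∑-allPts-𝟙-≟ {suc n} (false ∷ S) = trans (∑-allPts-suc n _)
  (trans (∑-cong (allPts n) (λ v → +-identityʳ (𝟙 (does (v ≟ₛ S))))) (∑-allPts-𝟙-≟ S))
∑-allPts-𝟙-≟ {suc n} (true ∷ S) = trans (∑-allPts-suc n _) (∑-allPts-𝟙-≟ S)

dot : ∀ {n} → Subset n → Pt n → Bool
dot S x = parity (zipWith _∧_ S x)

_⊕_ : ∀ {n} → Subset n → Subset n → Subset n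
_⊕_ = zipWith _xor_

open CommutativeSemigroupProperties (CommutativeRing.+-commutativeSemigroup xor-∧-commutativeRing)
  using () renaming (interchange to xor-interchange)

dot-linearˡ : ∀ {n} (S S' x : Subset n) → dot S x xor dot S' x ≡ dot (S ⊕ S') x
dot-linearˡ [] [] [] = refl
dot-linearˡ (s ∷ S) (s' ∷ S') (x ∷ v) = trans (xor-interchange (s ∧ x) (dot S v) (s' ∧ x) (dot S' v))
  (cong₂ _xor_ (sym (∧-distribʳ-xor x s s')) (dot-linearˡ S S' v))

⊕≡⊥⇒≡ : ∀ {n} (S S' : Subset n) → S ⊕ S' ≡ ⊥ → S ≡ S'
⊕≡⊥⇒≡ [] [] _ = refl
⊕≡⊥⇒≡ (true ∷ S) (true ∷ S') eq = cong (true ∷_) (⊕≡⊥⇒≡ S S' (cong tail eq))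
⊕≡⊥⇒≡ (false ∷ S) (false ∷ S') eq = cong (false ∷_) (⊕≡⊥⇒≡ S S' (cong tail eq))
⊕≡⊥⇒≡ (true ∷ S) (false ∷ S') ()
⊕≡⊥⇒≡ (false ∷ S) (true ∷ S') ()

χ-balanced : ∀ {n} (S : Subset n) → S ≢ ⊥ → 2 * ∑[ x ∈ allPts n ] 𝟙 (chi S x) ≡ 2 ^ n
χ-balanced [] S≢⊥ = contradiction refl S≢⊥
χ-balanced {suc n} (true ∷ S) _ = cong (2 *_) (begin
  ∑[ x ∈ allPts (suc n) ] 𝟙 (chi (true ∷ S) x)        ≡⟨ ∑-allPts-suc n _ ⟩
  ∑[ v ∈ allPts n ] (𝟙 (chi S v) + 𝟙 (not (chi S v))) ≡⟨ ∑-cong (allPts n) (𝟙-not ∘ chi S) ⟩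
  ∑[ _ ∈ allPts n ] 1                                  ≡⟨ ∑-allPts-1 n ⟩
  2 ^ n                                                ∎)
  where open ≡-Reasoning
χ-balanced {suc n} (false ∷ S) S≢⊥ = cong (2 *_) (begin
  ∑[ x ∈ allPts (suc n) ] 𝟙 (chi (false ∷ S) x)        ≡⟨ ∑-allPts-suc n _ ⟩
  ∑[ v ∈ allPts n ] (𝟙 (chi S v) + 𝟙 (chi S v))        ≡⟨ ∑-double (allPts n) _ ⟩
  2 * ∑[ v ∈ allPts n ] 𝟙 (chi S v)                    ≡⟨ χ-balanced S (S≢⊥ ∘ cong (false ∷_)) ⟩
  2 ^ n                                                ∎)
  where open ≡-Reasoning

joint-count : ∀ {n} → Subset n → Subset n → ℕ
joint-count {n} S S' = ∑[ x ∈ allPts n ] (𝟙 (chi S x) * 𝟙 (chi S' x))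

χ-balanced-4 : ∀ {n} (S : Subset n) → S ≢ ⊥ → 4 * ∑[ x ∈ allPts n ] 𝟙 (chi S x) ≡ 2 * 2 ^ n
χ-balanced-4 {n} S S≢⊥ = trans (*-assoc 2 2 (∑[ x ∈ allPts n ] 𝟙 (chi S x))) (cong (2 *_) (χ-balanced S S≢⊥))

χ-pairwise-independent : ∀ {n} (S S' : Subset n) → S ≢ ⊥ → S' ≢ ⊥ → S ≢ S' → 4 * joint-count S S' ≡ 2 ^ n
χ-pairwise-independent [] [] S≢⊥ _ _ = contradiction refl S≢⊥
χ-pairwise-independent {suc n} (false ∷ S) (false ∷ S') S≢⊥ S'≢⊥ S≢S' = begin
  4 * joint-count (false ∷ S) (false ∷ S')
    ≡⟨ cong (4 *_) (trans (∑-allPts-suc n _) (∑-double (allPts n) _)) ⟩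
  4 * (2 * joint-count S S')
    ≡⟨ x*yz≡y*xz 4 2 (joint-count S S') ⟩
  2 * (4 * joint-count S S')
    ≡⟨ cong (2 *_) (χ-pairwise-independent S S' (S≢⊥ ∘ cong (false ∷_)) (S'≢⊥ ∘ cong (false ∷_)) (S≢S' ∘ cong (false ∷_))) ⟩
  2 * 2 ^ n ∎
  where open ≡-Reasoning
χ-pairwise-independent {suc n} (true ∷ S) (false ∷ S') _ S'≢⊥ _ = begin
  4 * joint-count (true ∷ S) (false ∷ S')
    ≡⟨ cong (4 *_) (trans (∑-allPts-suc n _) (∑-cong (allPts n) λ v → 𝟙-not-* (chi S v) (𝟙 (chi S' v)))) ⟩
  4 * ∑[ v ∈ allPts n ] 𝟙 (chi S' v)
    ≡⟨ χ-balanced-4 S' (S'≢⊥ ∘ cong (false ∷_)) ⟩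
  2 * 2 ^ n ∎
  where open ≡-Reasoning
χ-pairwise-independent {suc n} (false ∷ S) (true ∷ S') S≢⊥ _ _ = begin
  4 * joint-count (false ∷ S) (true ∷ S')
    ≡⟨ cong (4 *_) (trans (∑-allPts-suc n _) (∑-cong (allPts n) λ v → *-𝟙-not (𝟙 (chi S v)) (chi S' v))) ⟩
  4 * ∑[ v ∈ allPts n ] 𝟙 (chi S v)
    ≡⟨ χ-balanced-4 S (S≢⊥ ∘ cong (false ∷_)) ⟩
  2 * 2 ^ n ∎
  where open ≡-Reasoning
χ-pairwise-independent {suc n} (true ∷ S) (true ∷ S') _ _ S≢S' = begin
  4 * joint-count (true ∷ S) (true ∷ S')
    ≡⟨ cong (4 *_) (trans (∑-allPts-suc n _) (∑-cong (allPts n) λ v → trans (𝟙-agreement (chi S v) (chi S' v)) (cong (𝟙 ∘ not) (chi-xor v)))) ⟩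
  4 * ∑[ v ∈ allPts n ] 𝟙 (chi (S ⊕ S') v)
    ≡⟨ χ-balanced-4 (S ⊕ S') (S≢S' ∘ cong (true ∷_) ∘ ⊕≡⊥⇒≡ S S') ⟩
  2 * 2 ^ n ∎
  where
  open ≡-Reasoning
  chi-xor : ∀ v → chi S v xor chi S' v ≡ dot (S ⊕ S') v
  chi-xor v = trans (xor-annihilates-not (dot S v) (dot S' v)) (dot-linearˡ S S' v)

∑-allPts-𝟙-∣∣≟ : ∀ n k → ∑[ S ∈ allPts n ] 𝟙 (does (∣ S ∣ ≟ k)) ≡ n C k
∑-allPts-𝟙-∣∣≟ zero zero = refl
∑-allPts-𝟙-∣∣≟ zero (suc k) = refl
∑-allPts-𝟙-∣∣≟ (suc n) zero = trans (∑-allPts-suc n _)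
  (trans (∑-cong (allPts n) (λ S → +-identityʳ (𝟙 (does (∣ S ∣ ≟ 0))))) (∑-allPts-𝟙-∣∣≟ n zero))
∑-allPts-𝟙-∣∣≟ (suc n) (suc k) = begin
  ∑[ S ∈ allPts (suc n) ] 𝟙 (does (∣ S ∣ ≟ suc k))
    ≡⟨ ∑-allPts-suc n _ ⟩
  ∑[ S ∈ allPts n ] (𝟙 (does (∣ S ∣ ≟ suc k)) + 𝟙 (does (∣ S ∣ ≟ k)))
    ≡⟨ ∑-distrib-+ (allPts n) _ _ ⟩
  ∑[ S ∈ allPts n ] 𝟙 (does (∣ S ∣ ≟ suc k)) + ∑[ S ∈ allPts n ] 𝟙 (does (∣ S ∣ ≟ k))
    ≡⟨ cong₂ _+_ (∑-allPts-𝟙-∣∣≟ n (suc k)) (∑-allPts-𝟙-∣∣≟ n k) ⟩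
  n C suc k + n C k
    ≡⟨ +-comm (n C suc k) (n C k) ⟩
  n C k + n C suc k
    ≡⟨ nCk+nC[k+1]≡[n+1]C[k+1] n k ⟩
  suc n C suc k ∎
  where open ≡-Reasoning

length-Pk : ∀ n k → length (Pk n k) ≡ n C k
length-Pk n k = trans (length-filter (λ S → ∣ S ∣ ≟ k) (allPts n)) (∑-allPts-𝟙-∣∣≟ n k)

-- Second moment of the multiplicity
supported : ∀ {n T} → Subset n → Vec (Pt n) T → ℕ
supported S = ∏ (𝟙 ∘ chi S)

multiplicity : ∀ {n T} → List (Subset n) → Vec (Pt n) T → ℕ
multiplicity 𝓕 xs = ∑[ S ∈ 𝓕 ] supported S xs

∑-multiplicity² : ∀ n T (𝓕 : List (Subset n)) →
  ∑[ xs ∈ allTuples n T ] (multiplicity 𝓕 xs * multiplicity 𝓕 xs) ≡ ∑[ S ∈ 𝓕 ] ∑[ S' ∈ 𝓕 ] (joint-count S S' ^ T)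
∑-multiplicity² n T 𝓕 = begin
  ∑[ xs ∈ L ] (multiplicity 𝓕 xs * multiplicity 𝓕 xs)
    ≡⟨ ∑-cong L expand ⟩
  ∑[ xs ∈ L ] ∑[ S ∈ 𝓕 ] ∑[ S' ∈ 𝓕 ] (supported S xs * supported S' xs)
    ≡⟨ ∑-comm L 𝓕 _ ⟩
  ∑[ S ∈ 𝓕 ] ∑[ xs ∈ L ] ∑[ S' ∈ 𝓕 ] (supported S xs * supported S' xs)
    ≡⟨ ∑-cong 𝓕 (λ S → ∑-comm L 𝓕 _) ⟩
  ∑[ S ∈ 𝓕 ] ∑[ S' ∈ 𝓕 ] ∑[ xs ∈ L ] (supported S xs * supported S' xs)
    ≡⟨ ∑-cong 𝓕 (λ S → ∑-cong 𝓕 λ S' → trans (∑-cong L (∏-* _ _)) (∑-allTuples-∏ n T _)) ⟩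
  ∑[ S ∈ 𝓕 ] ∑[ S' ∈ 𝓕 ] (joint-count S S' ^ T) ∎
  where
  open ≡-Reasoning
  L : List (Vec (Pt n) T)
  L = allTuples n T
  expand : ∀ xs → multiplicity 𝓕 xs * multiplicity 𝓕 xs ≡ ∑[ S ∈ 𝓕 ] ∑[ S' ∈ 𝓕 ] (supported S xs * supported S' xs)
  expand xs = trans (*-distribʳ-∑ _ 𝓕 _) (∑-cong 𝓕 λ S → *-distribˡ-∑ (supported S xs) 𝓕 _)

2^T*2^T*m^T≡[4*m]^T : ∀ T m → 2 ^ T * 2 ^ T * m ^ T ≡ (4 * m) ^ T
2^T*2^T*m^T≡[4*m]^T T m = trans (cong (_* m ^ T) (sym (^-distribʳ-* 2 2 T))) (sym (^-distribʳ-* 4 m T))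

joint-count-bound : ∀ {n} T (S S' : Subset n) → S ≢ ⊥ → S' ≢ ⊥ →
  2 ^ T * 2 ^ T * joint-count S S' ^ T ≤ (2 ^ n) ^ T + 𝟙 (does (S' ≟ₛ S)) * (2 ^ T * (2 ^ n) ^ T)
joint-count-bound {n} T S S' S≢⊥ S'≢⊥ with S' ≟ₛ S
... | yes refl = begin
  2 ^ T * 2 ^ T * joint-count S S ^ T        ≡⟨ 2^T*2^T*m^T≡[4*m]^T T (joint-count S S) ⟩
  (4 * joint-count S S) ^ T                  ≡⟨ cong (_^ T) (trans (*-assoc 2 2 (joint-count S S)) (cong (2 *_) 2*diagonal≡2^n)) ⟩
  (2 * 2 ^ n) ^ T                            ≡⟨ ^-distribʳ-* 2 (2 ^ n) T ⟩
  2 ^ T * (2 ^ n) ^ T                        ≤⟨ m≤n+m _ ((2 ^ n) ^ T) ⟩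
  (2 ^ n) ^ T + 2 ^ T * (2 ^ n) ^ T          ≡⟨ cong (_+_ ((2 ^ n) ^ T)) (sym (*-identityˡ _)) ⟩
  (2 ^ n) ^ T + 1 * (2 ^ T * (2 ^ n) ^ T)    ∎
  where
  open ≤-Reasoning
  2*diagonal≡2^n : 2 * joint-count S S ≡ 2 ^ n
  2*diagonal≡2^n = trans (cong (2 *_) (∑-cong (allPts n) (𝟙-idem ∘ chi S))) (χ-balanced S S≢⊥)
... | no S'≢S = begin
  2 ^ T * 2 ^ T * joint-count S S' ^ T       ≡⟨ 2^T*2^T*m^T≡[4*m]^T T (joint-count S S') ⟩
  (4 * joint-count S S') ^ T                 ≡⟨ cong (_^ T) (χ-pairwise-independent S S' S≢⊥ S'≢⊥ (S'≢S ∘ sym)) ⟩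
  (2 ^ n) ^ T                                ≤⟨ m≤m+n _ _ ⟩
  (2 ^ n) ^ T + 0 * (2 ^ T * (2 ^ n) ^ T)    ∎
  where open ≤-Reasoning

module _ {n : ℕ} (T : ℕ) {p : Level} {P : Pred (Subset n) p} (P? : Decidable P) (P⇒≢⊥ : ∀ S → P S → S ≢ ⊥) where

  private
    𝓕 : List (Subset n)
    𝓕 = filter P? (allPts n)
    M Q N : ℕ
    M = length 𝓕
    Q = 2 ^ T
    N = (2 ^ n) ^ T

  ∑-joint-count-row : ∀ S → S ≢ ⊥ → Q * Q * ∑[ S' ∈ 𝓕 ] (joint-count S S' ^ T) ≤ M * N + Q * N
  ∑-joint-count-row S S≢⊥ = begin
    Q * Q * ∑[ S' ∈ 𝓕 ] (joint-count S S' ^ T)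
      ≡⟨ *-distribˡ-∑ (Q * Q) 𝓕 _ ⟩
    ∑[ S' ∈ 𝓕 ] (Q * Q * (joint-count S S' ^ T))
      ≤⟨ ∑-filter-mono-≤ P? (allPts n) (λ S' PS' → joint-count-bound T S S' S≢⊥ (P⇒≢⊥ S' PS')) ⟩
    ∑[ S' ∈ 𝓕 ] (N + 𝟙 (does (S' ≟ₛ S)) * (Q * N))
      ≡⟨ ∑-distrib-+ 𝓕 _ _ ⟩
    ∑[ _ ∈ 𝓕 ] N + ∑[ S' ∈ 𝓕 ] (𝟙 (does (S' ≟ₛ S)) * (Q * N))
      ≡⟨ cong₂ _+_ (∑-const 𝓕 N) (sym (*-distribʳ-∑ (Q * N) 𝓕 _)) ⟩
    M * N + (∑[ S' ∈ 𝓕 ] 𝟙 (does (S' ≟ₛ S))) * (Q * N)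
      ≤⟨ +-monoʳ-≤ (M * N) (*-monoˡ-≤ (Q * N) S-occurs-at-most-once) ⟩
    M * N + 1 * (Q * N)
      ≡⟨ cong (_+_ (M * N)) (*-identityˡ (Q * N)) ⟩
    M * N + Q * N ∎
    where
    open ≤-Reasoning
    S-occurs-at-most-once : ∑[ S' ∈ 𝓕 ] 𝟙 (does (S' ≟ₛ S)) ≤ 1
    S-occurs-at-most-once = ≤-trans (∑-filter-≤ P? (allPts n) _) (≤-reflexive (∑-allPts-𝟙-≟ S))

  second-moment : Q * Q * ∑[ xs ∈ allTuples n T ] (multiplicity 𝓕 xs * multiplicity 𝓕 xs) ≤ M * M * N + M * Q * N
  second-moment = begin
    Q * Q * ∑[ xs ∈ allTuples n T ] (multiplicity 𝓕 xs * multiplicity 𝓕 xs)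
      ≡⟨ cong (Q * Q *_) (∑-multiplicity² n T 𝓕) ⟩
    Q * Q * ∑[ S ∈ 𝓕 ] ∑[ S' ∈ 𝓕 ] (joint-count S S' ^ T)
      ≡⟨ *-distribˡ-∑ (Q * Q) 𝓕 _ ⟩
    ∑[ S ∈ 𝓕 ] (Q * Q * ∑[ S' ∈ 𝓕 ] (joint-count S S' ^ T))
      ≤⟨ ∑-filter-mono-≤ P? (allPts n) (λ S PS → ∑-joint-count-row S (P⇒≢⊥ S PS)) ⟩
    ∑[ _ ∈ 𝓕 ] (M * N + Q * N)
      ≡⟨ ∑-const 𝓕 _ ⟩
    M * (M * N + Q * N)
      ≡⟨ *-distribˡ-+ M (M * N) (Q * N) ⟩
    M * (M * N) + M * (Q * N)
      ≡⟨ sym (cong₂ _+_ (*-assoc M M N) (*-assoc M Q N)) ⟩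
    M * M * N + M * Q * N ∎
    where open ≤-Reasoning

-- AM–GM and the counting inequality
am-gm-ordered : ∀ {x y} → x ≤ y → 2 * x * y ≤ x * x + y * y
am-gm-ordered {x} {y} x≤y = subst (λ z → 2 * x * z ≤ x * x + z * z) (m+[n∸m]≡n x≤y) (square-gap x (y ∸ x))
  where
  open ≤-Reasoning
  square-gap : ∀ a d → 2 * a * (a + d) ≤ a * a + (a + d) * (a + d)
  square-gap a d = begin
    2 * a * (a + d)                       ≤⟨ m≤m+n _ (d * d) ⟩
    2 * a * (a + d) + d * d               ≡⟨ solve (List ℕ ∋ a ∷ d ∷ []) ⟩
    a * a + (a + d) * (a + d)             ∎

am-gm : ∀ x y → 2 * x * y ≤ x * x + y * y
am-gm x y with ≤-total x y
... | inj₁ x≤y = am-gm-ordered x≤y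
... | inj₂ y≤x = begin
  2 * x * y      ≡⟨ solve (List ℕ ∋ x ∷ y ∷ []) ⟩
  2 * y * x      ≤⟨ am-gm-ordered y≤x ⟩
  y * y + x * x  ≡⟨ +-comm (y * y) (x * x) ⟩
  x * x + y * y  ∎
  where open ≤-Reasoning

𝟙-am-gm : ∀ M Q b c → 20 * M * Q * (𝟙 b * c) ≤ Q * Q * (c * c) + 100 * M * M * 𝟙 b
𝟙-am-gm M Q false c = ≤-trans (≤-reflexive (*-zeroʳ (20 * M * Q))) z≤n
𝟙-am-gm M Q true c = begin
  20 * M * Q * (1 * c)                  ≡⟨ solve (List ℕ ∋ M ∷ Q ∷ c ∷ []) ⟩
  2 * (Q * c) * (10 * M)                ≤⟨ am-gm (Q * c) (10 * M) ⟩
  Q * c * (Q * c) + 10 * M * (10 * M)   ≡⟨ solve (List ℕ ∋ M ∷ Q ∷ c ∷ []) ⟩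
  Q * Q * (c * c) + 100 * M * M * 1     ∎
  where open ≤-Reasoning

∑-𝟙-am-gm : ∀ (xs : List A) M Q (b : A → Bool) (c : A → ℕ) →
  20 * M * Q * ∑[ x ∈ xs ] (𝟙 (b x) * c x) ≤ Q * Q * ∑[ x ∈ xs ] (c x * c x) + 100 * M * M * ∑[ x ∈ xs ] 𝟙 (b x)
∑-𝟙-am-gm xs M Q b c = begin
  20 * M * Q * ∑[ x ∈ xs ] (𝟙 (b x) * c x)
    ≡⟨ *-distribˡ-∑ (20 * M * Q) xs _ ⟩
  ∑[ x ∈ xs ] (20 * M * Q * (𝟙 (b x) * c x))
    ≤⟨ ∑-mono-≤ xs (λ x → 𝟙-am-gm M Q (b x) (c x)) ⟩
  ∑[ x ∈ xs ] (Q * Q * (c x * c x) + 100 * M * M * 𝟙 (b x))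
    ≡⟨ ∑-distrib-+ xs _ _ ⟩
  ∑[ x ∈ xs ] (Q * Q * (c x * c x)) + ∑[ x ∈ xs ] (100 * M * M * 𝟙 (b x))
    ≡⟨ sym (cong₂ _+_ (*-distribˡ-∑ (Q * Q) xs _) (*-distribˡ-∑ (100 * M * M) xs _)) ⟩
  Q * Q * ∑[ x ∈ xs ] (c x * c x) + 100 * M * M * ∑[ x ∈ xs ] 𝟙 (b x) ∎
  where open ≤-Reasoning

m*m*n≤m*o*n⇒m≤o : ∀ m o n → 0 < n → m * m * n ≤ m * o * n → m ≤ o
m*m*n≤m*o*n⇒m≤o zero o n _ _ = z≤n
m*m*n≤m*o*n⇒m≤o m@(suc _) o n n>0 mmn≤mon =
  *-cancelʳ-≤ m o (m * n) (subst₂ _≤_ (*-assoc m m n) (trans (cong (_* n) (*-comm m o)) (*-assoc o m n)) mmn≤mon)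
  where
  instance
    n≢0 : NonZero n
    n≢0 = >-nonZero n>0
    mn≢0 : NonZero (m * n)
    mn≢0 = m*n≢0 m n

distinguishing-bound : ∀ M Q N A B t → 0 < N →
  M * (99 * N) ≤ 100 * (Q * A) →
  20 * M * Q * A ≤ Q * Q * B + 100 * M * M * t →
  Q * Q * B ≤ M * M * N + M * Q * N →
  100 * t ≤ N →
  M ≤ Q
distinguishing-bound M Q N A B t N>0 mass-bound am-gm-bound moment-bound rarity =
  m*m*n≤m*o*n⇒m≤o M Q N N>0 (*-cancelˡ-≤ 100 (≤-trans (*-monoˡ-≤ (M * M * N) (m≤m+n 100 1680))
    (+-cancelʳ-≤ (200 * (M * M * N)) _ _ chain)))
  where
  open ≤-Reasoning
  chain : 1780 * (M * M * N) + 200 * (M * M * N) ≤ 100 * (M * Q * N) + 200 * (M * M * N)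
  chain = begin
    1780 * (M * M * N) + 200 * (M * M * N)             ≡⟨ solve (List ℕ ∋ M ∷ N ∷ []) ⟩
    20 * M * (M * (99 * N))                            ≤⟨ *-monoʳ-≤ (20 * M) mass-bound ⟩
    20 * M * (100 * (Q * A))                           ≡⟨ solve (List ℕ ∋ M ∷ Q ∷ A ∷ []) ⟩
    100 * (20 * M * Q * A)                             ≤⟨ *-monoʳ-≤ 100 am-gm-bound ⟩
    100 * (Q * Q * B + 100 * M * M * t)                ≡⟨ solve (List ℕ ∋ M ∷ Q ∷ B ∷ t ∷ []) ⟩
    100 * (Q * Q * B) + 100 * M * M * (100 * t)        ≤⟨ +-mono-≤ (*-monoʳ-≤ 100 moment-bound) (*-monoʳ-≤ (100 * M * M) rarity) ⟩
    100 * (M * M * N + M * Q * N) + 100 * M * M * N    ≡⟨ solve (List ℕ ∋ M ∷ Q ∷ N ∷ []) ⟩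
    100 * (M * Q * N) + 200 * (M * M * N)              ∎

-- From probabilities to counts
ι : ℕ → ℚ
ι m = + m / 1

toℚᵘ-ι : ∀ m → toℚᵘ (ι m) ≃ᵘ mkℚᵘ (+ m) 0
toℚᵘ-ι m = QP.toℚᵘ-fromℚᵘ (mkℚᵘ (+ m) 0)

ι-homo-+ : ∀ m n → ι (m + n) ≡ ι m Q.+ ι n
ι-homo-+ m n = QP.toℚᵘ-injective (begin
  toℚᵘ (ι (m + n))               ≈⟨ toℚᵘ-ι (m + n) ⟩
  mkℚᵘ (+ (m + n)) 0             ≈⟨ *≡* (cong (ℤ._* + 1) (trans (ℤP.pos-+ m n) (sym (cong₂ ℤ._+_ (ℤP.*-identityʳ (+ m)) (ℤP.*-identityʳ (+ n)))))) ⟩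
  mkℚᵘ (+ m) 0 +ᵘ mkℚᵘ (+ n) 0   ≈⟨ ᵘP.+-cong (toℚᵘ-ι m) (toℚᵘ-ι n) ⟨
  toℚᵘ (ι m) +ᵘ toℚᵘ (ι n)       ≈⟨ QP.toℚᵘ-homo-+ (ι m) (ι n) ⟨
  toℚᵘ (ι m Q.+ ι n)             ∎)
  where open ᵘP.≃-Reasoning

ι-homo-* : ∀ m n → ι (m * n) ≡ ι m Q.* ι n
ι-homo-* m n = QP.toℚᵘ-injective (begin
  toℚᵘ (ι (m * n))               ≈⟨ toℚᵘ-ι (m * n) ⟩
  mkℚᵘ (+ (m * n)) 0             ≈⟨ *≡* (cong (ℤ._* + 1) (ℤP.pos-* m n)) ⟩
  mkℚᵘ (+ m) 0 *ᵘ mkℚᵘ (+ n) 0   ≈⟨ ᵘP.*-cong (toℚᵘ-ι m) (toℚᵘ-ι n) ⟨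
  toℚᵘ (ι m) *ᵘ toℚᵘ (ι n)       ≈⟨ QP.toℚᵘ-homo-* (ι m) (ι n) ⟨
  toℚᵘ (ι m Q.* ι n)             ∎)
  where open ᵘP.≃-Reasoning

inv-inverseˡ : ∀ m → inv (suc m) Q.* ι (suc m) ≡ 1ℚ
inv-inverseˡ m = QP.toℚᵘ-injective (begin
  toℚᵘ (inv (suc m) Q.* ι (suc m))          ≈⟨ QP.toℚᵘ-homo-* (inv (suc m)) (ι (suc m)) ⟩
  toℚᵘ (inv (suc m)) *ᵘ toℚᵘ (ι (suc m))    ≈⟨ ᵘP.*-cong (QP.toℚᵘ-fromℚᵘ (mkℚᵘ (+ 1) m)) (toℚᵘ-ι (suc m)) ⟩
  mkℚᵘ (+ 1) m *ᵘ mkℚᵘ (+ suc m) 0          ≈⟨ *≡* (cong (λ z → + suc z) (solve (List ℕ ∋ m ∷ []))) ⟩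
  mkℚᵘ (+ 1) 0                              ∎)
  where open ᵘP.≃-Reasoning

ι-nonNeg : ∀ m → Q.NonNegative (ι m)
ι-nonNeg m = QP.normalize-nonNeg m 1

ι-cancel-≤ : ∀ {m n} → ι m Q.≤ ι n → m ≤ n
ι-cancel-≤ {m} {n} ιm≤ιn with ᵘP.≤-respʳ-≃ (toℚᵘ-ι n) (ᵘP.≤-respˡ-≃ (toℚᵘ-ι m) (QP.toℚᵘ-mono-≤ ιm≤ιn))
... | *≤* m*1≤n*1 = ℤP.drop‿+≤+ (subst₂ ℤ._≤_ (ℤP.*-identityʳ (+ m)) (ℤP.*-identityʳ (+ n)) m*1≤n*1)

open CommutativeSemigroupProperties (CommutativeMonoid.commutativeSemigroup QP.*-1-commutativeMonoid)
  using () renaming (interchange to *ᵠ-interchange)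

if-then-0≡ι𝟙* : ∀ b q → (if b then q else 0ℚ) ≡ ι (𝟙 b) Q.* q
if-then-0≡ι𝟙* true q = sym (QP.*-identityˡ q)
if-then-0≡ι𝟙* false q = sym (QP.*-zeroˡ q)

sumℚ-ι : ∀ (xs : List A) (f : A → ℚ) h w → (∀ x → f x ≡ ι (h x) Q.* w) → sumℚ (map f xs) ≡ ι (∑ xs h) Q.* w
sumℚ-ι [] f h w f≗ιh*w = sym (QP.*-zeroˡ w)
sumℚ-ι (x ∷ xs) f h w f≗ιh*w = begin
  f x Q.+ sumℚ (map f xs)                ≡⟨ cong₂ Q._+_ (f≗ιh*w x) (sumℚ-ι xs f h w f≗ιh*w) ⟩
  ι (h x) Q.* w Q.+ ι (∑ xs h) Q.* w     ≡⟨ sym (QP.*-distribʳ-+ w (ι (h x)) (ι (∑ xs h))) ⟩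
  (ι (h x) Q.+ ι (∑ xs h)) Q.* w         ≡⟨ cong (Q._* w) (sym (ι-homo-+ (h x) (∑ xs h))) ⟩
  ι (h x + ∑ xs h) Q.* w                 ∎
  where open ≡-Reasoning

tupleProb-ι : ∀ {n T} (D : Dist n) h c → (∀ x → D x ≡ ι (h x) Q.* c) → (xs : Vec (Pt n) T) →
  tupleProb D xs ≡ ι (∏ h xs) Q.* c ^ᵠ T
tupleProb-ι D h c D≗ιh*c [] = refl
tupleProb-ι {T = suc T} D h c D≗ιh*c (x ∷ xs) = begin
  D x Q.* tupleProb D xs                            ≡⟨ cong₂ Q._*_ (D≗ιh*c x) (tupleProb-ι D h c D≗ιh*c xs) ⟩
  ι (h x) Q.* c Q.* (ι (∏ h xs) Q.* c ^ᵠ T)         ≡⟨ *ᵠ-interchange (ι (h x)) c (ι (∏ h xs)) (c ^ᵠ T) ⟩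
  ι (h x) Q.* ι (∏ h xs) Q.* (c Q.* c ^ᵠ T)         ≡⟨ cong (Q._* (c Q.* c ^ᵠ T)) (sym (ι-homo-* (h x) (∏ h xs))) ⟩
  ι (h x * ∏ h xs) Q.* c ^ᵠ suc T                   ∎
  where open ≡-Reasoning

inv-^-inverseˡ : ∀ m T → inv (suc m) ^ᵠ T Q.* ι (suc m ^ T) ≡ 1ℚ
inv-^-inverseˡ m zero = refl
inv-^-inverseˡ m (suc T) = begin
  inv (suc m) Q.* inv (suc m) ^ᵠ T Q.* ι (suc m * suc m ^ T)
    ≡⟨ cong (inv (suc m) Q.* inv (suc m) ^ᵠ T Q.*_) (ι-homo-* (suc m) (suc m ^ T)) ⟩
  inv (suc m) Q.* inv (suc m) ^ᵠ T Q.* (ι (suc m) Q.* ι (suc m ^ T))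
    ≡⟨ *ᵠ-interchange (inv (suc m)) (inv (suc m) ^ᵠ T) (ι (suc m)) (ι (suc m ^ T)) ⟩
  inv (suc m) Q.* ι (suc m) Q.* (inv (suc m) ^ᵠ T Q.* ι (suc m ^ T))
    ≡⟨ cong₂ Q._*_ (inv-inverseˡ m) (inv-^-inverseˡ m T) ⟩
  1ℚ ∎
  where open ≡-Reasoning

99/100≤ιm*w⇒99d≤100m : ∀ m d w → w Q.* ι d ≡ 1ℚ → (+ 99 / 100) Q.≤ ι m Q.* w → 99 * d ≤ 100 * m
99/100≤ιm*w⇒99d≤100m m d w w*ιd≡1 99/100≤ιm*w = ι-cancel-≤ (begin
  ι (99 * d)                          ≡⟨ ι-homo-* 99 d ⟩
  -- ι 99 and ι 100 Q.* (+ 99 / 100) have the same closed normal form.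
  ι 100 Q.* (+ 99 / 100) Q.* ι d      ≡⟨ QP.*-assoc (ι 100) (+ 99 / 100) (ι d) ⟩
  ι 100 Q.* ((+ 99 / 100) Q.* ι d)    ≤⟨ QP.*-monoˡ-≤-nonNeg (ι 100) {{ι-nonNeg 100}} (QP.*-monoʳ-≤-nonNeg (ι d) {{ι-nonNeg d}} 99/100≤ιm*w) ⟩
  ι 100 Q.* (ι m Q.* w Q.* ι d)       ≡⟨ cong (ι 100 Q.*_) (trans (QP.*-assoc (ι m) w (ι d)) (trans (cong (ι m Q.*_) w*ιd≡1) (QP.*-identityʳ (ι m)))) ⟩
  ι 100 Q.* ι m                       ≡⟨ sym (ι-homo-* 100 m) ⟩
  ι (100 * m)                         ∎)
  where open QP.≤-Reasoning

outputs : ∀ n k T → Bool → Vec (Pt n) T → ℕ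
outputs n k T b xs = 𝟙 (does (mle n k T xs Bool.≟ b))

probOutput-ι : ∀ n k T (D : Dist n) h c b → (∀ x → D x ≡ ι (h x) Q.* c) →
  probOutput n k T D b ≡ ι (∑[ xs ∈ allTuples n T ] (outputs n k T b xs * ∏ h xs)) Q.* c ^ᵠ T
probOutput-ι n k T D h c b D≗ιh*c = sumℚ-ι (allTuples n T) _ _ _ term
  where
  open ≡-Reasoning
  term : ∀ xs → (if does (mle n k T xs Bool.≟ b) then tupleProb D xs else 0ℚ) ≡ ι (outputs n k T b xs * ∏ h xs) Q.* c ^ᵠ T
  term xs = begin
    (if does (mle n k T xs Bool.≟ b) then tupleProb D xs else 0ℚ)    ≡⟨ if-then-0≡ι𝟙* (does (mle n k T xs Bool.≟ b)) (tupleProb D xs) ⟩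
    ι (outputs n k T b xs) Q.* tupleProb D xs                          ≡⟨ cong (ι (outputs n k T b xs) Q.*_) (tupleProb-ι D h c D≗ιh*c xs) ⟩
    ι (outputs n k T b xs) Q.* (ι (∏ h xs) Q.* c ^ᵠ T)                 ≡⟨ sym (QP.*-assoc (ι (outputs n k T b xs)) (ι (∏ h xs)) (c ^ᵠ T)) ⟩
    ι (outputs n k T b xs) Q.* ι (∏ h xs) Q.* c ^ᵠ T                   ≡⟨ cong (Q._* c ^ᵠ T) (sym (ι-homo-* (outputs n k T b xs) (∏ h xs))) ⟩
    ι (outputs n k T b xs * ∏ h xs) Q.* c ^ᵠ T                         ∎

probOutput-≥99/100 : ∀ n k T (D : Dist n) h d b → 1 ≤ d → (∀ x → D x ≡ ι (h x) Q.* inv d) →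
  (+ 99 / 100) Q.≤ probOutput n k T D b → 99 * d ^ T ≤ 100 * ∑[ xs ∈ allTuples n T ] (outputs n k T b xs * ∏ h xs)
probOutput-≥99/100 n k T D h d@(suc d-1) b _ D≗ιh*invd 99/100≤prob =
  99/100≤ιm*w⇒99d≤100m (∑[ xs ∈ allTuples n T ] (outputs n k T b xs * ∏ h xs)) (d ^ T) (inv d ^ᵠ T) (inv-^-inverseˡ d-1 T)
    (subst ((+ 99 / 100) Q.≤_) (probOutput-ι n k T D h (inv d) b D≗ιh*invd) 99/100≤prob)

∏-const-1 : ∀ {T} (xs : Vec A T) → ∏ (λ _ → 1) xs ≡ 1
∏-const-1 [] = refl
∏-const-1 (x ∷ xs) = trans (+-identityʳ _) (∏-const-1 xs)

uniform-acceptance-bound : ∀ n k T → (+ 99 / 100) Q.≤ probOutput n k T (U n) false →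
  100 * ∑ (allTuples n T) (outputs n k T true) ≤ (2 ^ n) ^ T
uniform-acceptance-bound n k T 99/100≤prob = +-cancelˡ-≤ (99 * N) _ _ (begin
  99 * N + 100 * t     ≤⟨ +-monoˡ-≤ (100 * t) correct-on-uniform ⟩
  100 * F + 100 * t    ≡⟨ sym (*-distribˡ-+ 100 F t) ⟩
  100 * (F + t)        ≡⟨ cong (100 *_) F+t≡N ⟩
  100 * N              ≡⟨ +-comm N (99 * N) ⟩
  99 * N + N           ∎)
  where
  open ≤-Reasoning
  N F t : ℕ
  N = (2 ^ n) ^ T
  F = ∑[ xs ∈ allTuples n T ] (outputs n k T false xs * ∏ (λ _ → 1) xs)
  t = ∑ (allTuples n T) (outputs n k T true)
  correct-on-uniform : 99 * N ≤ 100 * F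
  correct-on-uniform = subst (λ d → 99 * d ^ T ≤ 100 * F) (length-allPts n)
    (probOutput-≥99/100 n k T (U n) (λ _ → 1) (length (allPts n)) false
      (subst (1 ≤_) (sym (length-allPts n)) (m^n>0 2 n)) (λ _ → sym (QP.*-identityˡ _)) 99/100≤prob)
  outputs-partition : ∀ xs → outputs n k T false xs * ∏ (λ _ → 1) xs + outputs n k T true xs ≡ ∏ (λ _ → 1) xs
  outputs-partition xs rewrite ∏-const-1 xs = trans (cong (_+ outputs n k T true xs) (*-identityʳ _)) (𝟙-≟-partition (mle n k T xs) false)
  F+t≡N : F + t ≡ N
  F+t≡N = trans (sym (∑-distrib-+ (allTuples n T) _ _)) (trans (∑-cong (allTuples n T) outputs-partition)
    (trans (∑-allTuples-∏ n T (λ _ → 1)) (cong (_^ T) (∑-allPts-1 n))))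

truncated-acceptance-bound : ∀ n k T (S : Subset n) → S ≢ ⊥ → (+ 99 / 100) Q.≤ probOutput n k T (Utrunc S) true →
  99 * (2 ^ n) ^ T ≤ 100 * (2 ^ T * ∑[ xs ∈ allTuples n T ] (outputs n k T true xs * supported S xs))
truncated-acceptance-bound n k T S S≢⊥ 99/100≤prob = begin
  99 * (2 ^ n) ^ T           ≡⟨ cong (λ m → 99 * m ^ T) (sym 2h≡2^n) ⟩
  99 * (2 * h) ^ T           ≡⟨ cong (99 *_) (^-distribʳ-* 2 h T) ⟩
  99 * (2 ^ T * h ^ T)       ≡⟨ x*yz≡y*xz 99 (2 ^ T) (h ^ T) ⟩
  2 ^ T * (99 * h ^ T)       ≤⟨ *-monoʳ-≤ (2 ^ T) correct-on-truncated ⟩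
  2 ^ T * (100 * accepted)   ≡⟨ x*yz≡y*xz (2 ^ T) 100 accepted ⟩
  100 * (2 ^ T * accepted)   ∎
  where
  open ≤-Reasoning
  h accepted : ℕ
  h = length (filter (λ y → chi S y Bool.≟ true) (allPts n))
  accepted = ∑[ xs ∈ allTuples n T ] (outputs n k T true xs * supported S xs)
  2h≡2^n : 2 * h ≡ 2 ^ n
  2h≡2^n = trans (cong (2 *_) (trans (length-filter _ (allPts n)) (∑-cong (allPts n) (𝟙-≟-true ∘ chi S))))
    (χ-balanced S S≢⊥)
  correct-on-truncated : 99 * h ^ T ≤ 100 * accepted
  correct-on-truncated = probOutput-≥99/100 n k T (Utrunc S) (𝟙 ∘ chi S) h true
    (*-cancelˡ-< 2 0 h (subst (0 <_) (sym 2h≡2^n) (m^n>0 2 n))) (λ x → if-then-0≡ι𝟙* (chi S x) (inv h)) 99/100≤prob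

weight≡k⇒≢⊥ : ∀ {n k} → 1 ≤ k → (S : Subset n) → ∣ S ∣ ≡ k → S ≢ ⊥
weight≡k⇒≢⊥ {n} 1≤k S ∣S∣≡k refl = <⇒≢ 1≤k (trans (sym (∣⊥∣≡0 n)) ∣S∣≡k)

averaged-acceptance-bound : ∀ n k T → 1 ≤ k →
  ((S : Subset n) → ∣ S ∣ ≡ k → (+ 99 / 100) Q.≤ probOutput n k T (Utrunc S) true) →
  length (Pk n k) * (99 * (2 ^ n) ^ T) ≤ 100 * (2 ^ T * ∑[ xs ∈ allTuples n T ] (outputs n k T true xs * multiplicity (Pk n k) xs))
averaged-acceptance-bound n k T 1≤k truncated-ok = begin
  length 𝓕 * (99 * (2 ^ n) ^ T)
    ≡⟨ sym (∑-const 𝓕 _) ⟩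
  ∑[ _ ∈ 𝓕 ] (99 * (2 ^ n) ^ T)
    ≤⟨ ∑-filter-mono-≤ (λ S → ∣ S ∣ ≟ k) (allPts n) (λ S ∣S∣≡k →
         truncated-acceptance-bound n k T S (weight≡k⇒≢⊥ 1≤k S ∣S∣≡k) (truncated-ok S ∣S∣≡k)) ⟩
  ∑[ S ∈ 𝓕 ] (100 * (2 ^ T * accepted S))
    ≡⟨ sym (trans (cong (100 *_) (*-distribˡ-∑ (2 ^ T) 𝓕 accepted)) (*-distribˡ-∑ 100 𝓕 _)) ⟩
  100 * (2 ^ T * ∑ 𝓕 accepted)
    ≡⟨ cong (λ a → 100 * (2 ^ T * a)) (trans (∑-comm 𝓕 (allTuples n T) _)
         (∑-cong (allTuples n T) λ xs → sym (*-distribˡ-∑ (outputs n k T true xs) 𝓕 _))) ⟩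
  100 * (2 ^ T * ∑[ xs ∈ allTuples n T ] (outputs n k T true xs * multiplicity 𝓕 xs)) ∎
  where
  open ≤-Reasoning
  𝓕 : List (Subset n)
  𝓕 = Pk n k
  accepted : Subset n → ℕ
  accepted S = ∑[ xs ∈ allTuples n T ] (outputs n k T true xs * supported S xs)

proposition4p5 : (n k T : ℕ) → 1 ≤ k → k ≤ n →
    (+ 99 / 100) Q.≤ probOutput n k T (U n) false →
    ((S : Subset n) → ∣ S ∣ ≡ k → (+ 99 / 100) Q.≤ probOutput n k T (Utrunc S) true) →
    n C k ≤ 2 ^ T
proposition4p5 n k T 1≤k _ uniform-ok truncated-ok =
  subst (_≤ 2 ^ T) (length-Pk n k)
    (distinguishing-bound (length (Pk n k)) (2 ^ T) ((2 ^ n) ^ T) _ _ _ (m^n>0 (2 ^ n) {{m^n≢0 2 n}} T)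
      (averaged-acceptance-bound n k T 1≤k truncated-ok)
      (∑-𝟙-am-gm (allTuples n T) (length (Pk n k)) (2 ^ T) (λ xs → does (mle n k T xs Bool.≟ true)) (multiplicity (Pk n k)))
      (second-moment T (λ S → ∣ S ∣ ≟ k) (weight≡k⇒≢⊥ 1≤k))
      (uniform-acceptance-bound n k T uniform-ok))
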